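{- Let $k,n$ be positive integers with $k^2-k+1\le n\le k^2$, and let $t,r_1,\dots,r_t,s_1,\dots,s_t$ be positive integers such that $r_1s_1+\dots+r_ts_t=n$ and $r_1>r_2>\dots>r_t$ (the latter condition being vacuous for $t=1$). Then $r_1+s_1+s_2+\dots+s_t\ge 2k$. -}

module Defs where

open import Data.Nat using (ℕ; zero; suc; _+_; _*_)
open import Data.Fin using (Fin; zero; suc)

sumFin : (t : ℕ) → (Fin t → ℕ) → ℕ
sumFin zero    f = 0
sumFin (suc t) f = f zero + sumFin t (λ i → f (suc i))

-- With R = r₁ the largest part and S = s₁ + ⋯ + sₜ, we have n = Σ rᵢsᵢ ≤ R S, and by AM–GM
-- 4n ≤ 4RS ≤ (R + S)². If R + S ≤ 2k − 1 this gives 4(k² − k + 1) ≤ 4n ≤ 4(k² − k) + 1,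
-- which is impossible.
module Submission where

open import Defs
open import Data.Nat using (ℕ; zero; suc; _+_; _*_; _∸_; _≤_; _<_; z≤n; s≤s)
open import Data.Nat.Properties
open import Data.Nat.Solver using (module +-*-Solver)
open import Data.Fin using (Fin; zero; suc) renaming (_<_ to _<ᶠ_)
open import Data.Product using (_,_)
open import Data.Sum using (inj₁; inj₂)
open import Relation.Binary.PropositionalEquality using (_≡_; refl; sym; cong)

open +-*-Solver

sumFin-*-≤ : (t c : ℕ) (f g : Fin t → ℕ) → (∀ i → f i ≤ c) →
             sumFin t (λ i → f i * g i) ≤ c * sumFin t g
sumFin-*-≤ zero    c f g f≤c = z≤n
sumFin-*-≤ (suc t) c f g f≤c = begin
  f zero * g zero + sumFin t (λ i → f (suc i) * g (suc i))
    ≤⟨ +-mono-≤ (*-monoˡ-≤ (g zero) (f≤c zero))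
                (sumFin-*-≤ t c (λ i → f (suc i)) (λ i → g (suc i)) (λ i → f≤c (suc i))) ⟩
  c * g zero + c * sumFin t (λ i → g (suc i))
    ≡⟨ sym (*-distribˡ-+ c (g zero) _) ⟩
  c * sumFin (suc t) g ∎
  where open ≤-Reasoning

strictly-decreasing⇒head-max : (m : ℕ) (r : Fin (suc m) → ℕ) →
                               (∀ i j → i <ᶠ j → r j < r i) → ∀ i → r i ≤ r zero
strictly-decreasing⇒head-max m r dec zero    = ≤-refl
strictly-decreasing⇒head-max m r dec (suc i) = <⇒≤ (dec zero (suc i) (s≤s z≤n))

4*-≤-square-of-+-ordered : ∀ a b → a ≤ b → 4 * (a * b) ≤ (a + b) * (a + b)
4*-≤-square-of-+-ordered a b a≤b with m≤n⇒∃[o]m+o≡n a≤b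
... | d , refl = begin
  4 * (a * (a + d))               ≤⟨ m≤m+n _ (d * d) ⟩
  4 * (a * (a + d)) + d * d       ≡⟨ solve 2 (λ a d → con 4 :* (a :* (a :+ d)) :+ d :* d
                                            := (a :+ (a :+ d)) :* (a :+ (a :+ d))) refl a d ⟩
  (a + (a + d)) * (a + (a + d))   ∎
  where open ≤-Reasoning

4*-≤-square-of-+ : ∀ a b → 4 * (a * b) ≤ (a + b) * (a + b)
4*-≤-square-of-+ a b with ≤-total a b
... | inj₁ a≤b = 4*-≤-square-of-+-ordered a b a≤b
... | inj₂ b≤a = begin
  4 * (a * b)         ≡⟨ cong (4 *_) (*-comm a b) ⟩
  4 * (b * a)         ≤⟨ 4*-≤-square-of-+-ordered b a b≤a ⟩
  (b + a) * (b + a)   ≡⟨ cong (λ x → x * x) (+-comm b a) ⟩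
  (a + b) * (a + b)   ∎
  where open ≤-Reasoning

square-lower-bound : ∀ k n x → (k * k ∸ k) + 1 ≤ n → 4 * n ≤ x * x → 2 * k ≤ x
square-lower-bound zero    n x _  _    = z≤n
square-lower-bound (suc k) n x lo 4n≤x² =
  ≮⇒≥ λ x<2[1+k] → <-irrefl refl (too-small (≤-pred (≤-trans x<2[1+k] (≤-reflexive 2[1+k]≡2+2k))))
  where
  q : ℕ
  q = k * suc k
  2[1+k]≡2+2k : 2 * suc k ≡ suc (2 * k + 1)
  2[1+k]≡2+2k = solve 1 (λ k → con 2 :* (con 1 :+ k) := con 1 :+ (con 2 :* k :+ con 1)) refl k
  too-small : x ≤ 2 * k + 1 → 4 * q + 4 < 4 * q + 4
  too-small x≤2k+1 = begin-strict
    4 * q + 4                         ≡⟨ sym (*-distribˡ-+ 4 q 1) ⟩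
    4 * (q + 1)                     ≡⟨ cong (λ y → 4 * (y + 1)) (sym (m+n∸m≡n k q)) ⟩
    4 * ((suc k * suc k ∸ suc k) + 1) ≤⟨ *-monoʳ-≤ 4 lo ⟩
    4 * n                           ≤⟨ 4n≤x² ⟩
    x * x                           ≤⟨ *-mono-≤ x≤2k+1 x≤2k+1 ⟩
    (2 * k + 1) * (2 * k + 1)       ≡⟨ solve 1 (λ k → (con 2 :* k :+ con 1) :* (con 2 :* k :+ con 1)
                                              := con 4 :* (k :* (con 1 :+ k)) :+ con 1) refl k ⟩
    4 * q + 1                       <⟨ +-monoʳ-< (4 * q) (s≤s (s≤s z≤n)) ⟩
    4 * q + 4                       ∎
    where open ≤-Reasoning

proposition7p1 : (k n : ℕ) → 1 ≤ k → 1 ≤ n → (k * k ∸ k) + 1 ≤ n → n ≤ k * k →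
                 (m : ℕ) → (r s : Fin (suc m) → ℕ) →
                 (∀ i → 1 ≤ r i) → (∀ i → 1 ≤ s i) →
                 sumFin (suc m) (λ i → r i * s i) ≡ n →
                 (∀ i j → i <ᶠ j → r j < r i) →
                 2 * k ≤ r zero + sumFin (suc m) s
proposition7p1 k n _ _ lo _ m r s _ _ sum≡n dec =
  square-lower-bound k n (R + S) lo (begin
    4 * n               ≡⟨ cong (4 *_) (sym sum≡n) ⟩
    4 * sumFin (suc m) (λ i → r i * s i)
                        ≤⟨ *-monoʳ-≤ 4 (sumFin-*-≤ (suc m) R r s
                                          (strictly-decreasing⇒head-max m r dec)) ⟩
    4 * (R * S)         ≤⟨ 4*-≤-square-of-+ R S ⟩
    (R + S) * (R + S)   ∎)
  where
  open ≤-Reasoning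
  R S : ℕ
  R = r zero
  S = sumFin (suc m) s
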